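{- Let $G$ be a finite connected graph of order $n\geq 2$ and minimum degree $\delta(G)$. Then $\rho_{o}(G)=\frac{n}{\delta(G)}$ if and only if $G\in\Gamma$.
   Context: For a vertex $v$, $N(v)$ is its open neighbourhood. A set $B\subseteq V(G)$ is an open packing if $N(u)\cap N(v)=\emptyset$ for all distinct $u,v\in B$; $\rho_o(G)$ is the maximum cardinality of an open packing in $G$. The family $\Gamma$ consists of all graphs $G$ constructed as follows: choose integers $t\geq 1$ and $k\geq 0$; let $H$ be the disjoint union of $t$ copies of $K_2$; for each vertex $u$ of $H$ add a set $pn(u)$ of $k$ new vertices, each joined to $u$ only (the sets $pn(u)$ pairwise disjoint and disjoint from $V(H)$); then add edges only among vertices of $\bigcup_{u\in V(H)}pn(u)$ so that the resulting graph $G$ on $V(H)\cup\bigcup_{u\in V(H)}pn(u)$ is connected and every vertex $v\in\bigcup_{u\in V(H)}pn(u)$ has $\deg(v)\geq k+1$. (Then each vertex of $H$ has degree $\delta(G)=k+1$ and each vertex outside $V(H)$ has exactly one neighbour in $V(H)$.) -}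

module Defs where

open import Data.Nat using (ℕ; zero; suc; _≤_)
open import Data.Bool using (Bool; true; false; if_then_else_)
open import Data.Fin using (Fin; zero; suc)
open import Data.Fin.Subset using (Subset; _∈_; ∣_∣)
open import Data.List using (List; map; allFin)
open import Data.Nat.ListAction using (sum)
open import Data.Product using (Σ; Σ-syntax; ∃; _×_; _,_; proj₁; proj₂)
open import Relation.Binary.PropositionalEquality using (_≡_; _≢_)
open import Relation.Nullary using (¬_)
open import Function.Bundles using (_⤖_; _⇔_; Bijection)

record Graph (n : ℕ) : Set where
  field
    adj       : Fin n → Fin n → Bool
    adj-sym   : ∀ u v → adj u v ≡ adj v u
    adj-irrefl : ∀ v → adj v v ≡ false

module _ {n : ℕ} (G : Graph n) where
  open Graph G

  Adj : Fin n → Fin n → Set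
  Adj u v = adj u v ≡ true

  deg : Fin n → ℕ
  deg v = sum (map (λ w → if adj v w then 1 else 0) (allFin n))

  IsMinDegree : ℕ → Set
  IsMinDegree d = (∃ λ v → deg v ≡ d) × (∀ v → d ≤ deg v)

  data Walk : Fin n → Fin n → Set where
    here : ∀ {v} → Walk v v
    step : ∀ {u v w} → Adj u v → Walk v w → Walk u w

  Connected : Set
  Connected = ∀ u v → Walk u v

  IsOpenPacking : Subset n → Set
  IsOpenPacking B = ∀ u v → u ∈ B → v ∈ B → u ≢ v → ∀ w → ¬ (Adj u w × Adj v w)

  IsOpenPackingNumber : ℕ → Set
  IsOpenPackingNumber r =
    (Σ[ B ∈ Subset n ] (IsOpenPacking B × ∣ B ∣ ≡ r))
    × (∀ B → IsOpenPacking B → ∣ B ∣ ≤ r)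

  -- G ∈ Γ: the vertices are labelled bijectively by (i , j , c) with
  -- i ∈ Fin t (which copy of K₂), j ∈ Fin 2 (which end of that K₂),
  -- c = zero for the vertex u = (i , j) of H, and c = suc l for the
  -- l-th vertex of pn(u).
  module _ (t k : ℕ) (φ : Fin n ⤖ (Fin t × Fin 2 × Fin (suc k))) where
    private
      lab = Bijection.to φ
    copy : Fin n → Fin t
    copy v = proj₁ (lab v)
    side : Fin n → Fin 2
    side v = proj₁ (proj₂ (lab v))
    role : Fin n → Fin (suc k)
    role v = proj₂ (proj₂ (lab v))

    GammaStructure : Set
    GammaStructure =
      (∀ u v → role u ≡ zero → role v ≡ zero →
         (Adj u v ⇔ (copy u ≡ copy v × u ≢ v)))
      × (∀ u v → role u ≡ zero → role v ≢ zero →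
         (Adj u v ⇔ (copy u ≡ copy v × side u ≡ side v)))
      -- edges among pn-vertices are arbitrary, subject to degree ≥ k+1
      × (∀ v → role v ≢ zero → suc k ≤ deg v)

  InΓ : Set
  InΓ = Σ[ t ∈ ℕ ] Σ[ k ∈ ℕ ] (1 ≤ t) ×
          Σ[ φ ∈ (Fin n ⤖ (Fin t × Fin 2 × Fin (suc k))) ]
            (GammaStructure t k φ × Connected)

-- Each vertex has at most one neighbour in an open packing B, so counting the edges between B
-- and V(G) gives |B| δ ≤ Σ_{u ∈ B} deg u ≤ n. If ρ_o δ = n, both inequalities are equalities
-- for a maximum open packing B: every vertex w has exactly one neighbour π w in B, and every
-- vertex of B has degree δ = k + 1. Then π is a fixed-point-free involution on B, so the edges
-- {a, π a} form t disjoint copies of K₂, and the remaining k neighbours of a ∈ B are exactly the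
-- vertices w ∉ B with π w = a; labelling every vertex by its copy, its side and its position
-- among these exhibits G ∈ Γ. Conversely, if G ∈ Γ then V(H) is an open packing, δ ≥ k + 1 and
-- n = |V(H)| (k + 1) ≤ ρ_o δ.
module Submission where

open import Defs

open import Data.Bool using (Bool; true; false; if_then_else_; _∧_; not)
open import Data.Bool.Properties using (∧-conicalˡ; ∧-conicalʳ; ∧-comm; not-¬; ¬-not; not-involutive)
open import Data.Fin using (Fin; zero; suc; cast; toℕ; fromℕ<; punchOut; combine; opposite)
open import Data.Fin.Properties as Finₚ
  using (injective⇒≤; toℕ-injective; toℕ-cast; 0≢1+n; 2↔Bool; <-cmp; <-asym; any?;
         punchOut-injective; combine-injective)
  renaming (_≟_ to _≟ᶠ_; _<?_ to _<?ᶠ_)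
open import Data.Fin.Subset using (Subset; ∣_∣; _∈_)
open import Data.List using (map; tabulate)
open import Data.Nat using (ℕ; zero; suc; _+_; _*_; _≤_; _<_; z≤n; s≤s)
open import Data.Nat.ListAction as List using ()
open import Data.Nat.Properties
  using (module ≤-Reasoning; suc-injective; +-identityʳ; *-identityˡ; *-zeroʳ; *-assoc; *-comm;
         ≤-antisym; ≤-trans; ≤-reflexive; <⇒≱; m≤n⇒m<n∨m≡n;
         +-mono-≤; +-monoˡ-≤; +-monoʳ-≤; +-mono-<-≤; +-mono-≤-<; *-mono-≤; *-monoˡ-≤; *-monoʳ-≤; +-*-semiring)
open import Algebra.Properties.Semiring.Sum +-*-semiring
  using (sum; sum-syntax; sum-cong-≗; ∑-distrib-+; ∑-comm; *-distribˡ-sum; *-distribʳ-sum)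
open import Data.Product using (∃; _×_; _,_; proj₁; proj₂)
open import Data.Sum using (_⊎_; inj₁; inj₂)
open import Data.Vec as Vec using (lookup)
open import Data.Vec.Properties using (lookup⇒[]=; []=⇒lookup; lookup∘tabulate; tabulate∘lookup)
open import Function using (_∘_; id)
open import Function.Bundles using (_⤖_; _⇔_; mk⇔; mk⤖; Bijection; Equivalence; Inverse)
open import Function.Consequences.Propositional using (strictlySurjective⇒surjective)
open import Function.Definitions using (Injective; StrictlySurjective)
open import Relation.Binary using (tri<; tri≈; tri>)
open import Relation.Binary.PropositionalEquality
open import Relation.Nullary using (yes; no; does; contradiction)
open import Relation.Nullary.Decidable using (dec-true; dec-false)

-- Counting over Fin n

indicator : Bool → ℕ
indicator b = if b then 1 else 0

indicator-∧ : ∀ x y → indicator (x ∧ y) ≡ indicator x * indicator y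
indicator-∧ false y = refl
indicator-∧ true  y = sym (+-identityʳ (indicator y))

indicator-split : ∀ x y → indicator x ≡ indicator (x ∧ y) + indicator (x ∧ not y)
indicator-split false y     = refl
indicator-split true  true  = refl
indicator-split true  false = refl

count : ∀ {n} → (Fin n → Bool) → ℕ
count {n} p = ∑[ i < n ] indicator (p i)

∑-one : ∀ n → ∑[ i < n ] 1 ≡ n
∑-one zero    = refl
∑-one (suc n) = cong suc (∑-one n)

∑-mono-≤ : ∀ {n} {f g : Fin n → ℕ} → (∀ i → f i ≤ g i) → sum f ≤ sum g
∑-mono-≤ {zero}  f≤g = z≤n
∑-mono-≤ {suc n} f≤g = +-mono-≤ (f≤g zero) (∑-mono-≤ (f≤g ∘ suc))

∑-mono-< : ∀ {n} {f g : Fin n → ℕ} → (∀ i → f i ≤ g i) → ∀ j → f j < g j → sum f < sum g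
∑-mono-< f≤g zero    fj<gj = +-mono-<-≤ fj<gj (∑-mono-≤ (f≤g ∘ suc))
∑-mono-< f≤g (suc j) fj<gj = +-mono-≤-< (f≤g zero) (∑-mono-< (f≤g ∘ suc) j fj<gj)

∑-mono-≤-equality : ∀ {n} {f g : Fin n → ℕ} → (∀ i → f i ≤ g i) → sum g ≤ sum f → ∀ i → f i ≡ g i
∑-mono-≤-equality f≤g ∑g≤∑f i with m≤n⇒m<n∨m≡n (f≤g i)
... | inj₁ fi<gi = contradiction ∑g≤∑f (<⇒≱ (∑-mono-< f≤g i fi<gi))
... | inj₂ fi≡gi = fi≡gi

sum-map-tabulate : ∀ {a} {A : Set a} n (g : Fin n → A) (f : A → ℕ) →
                   List.sum (map f (tabulate g)) ≡ ∑[ i < n ] f (g i)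
sum-map-tabulate zero    g f = refl
sum-map-tabulate (suc n) g f = cong (f (g zero) +_) (sum-map-tabulate n (g ∘ suc) f)

∣tabulate∣ : ∀ {n} (p : Fin n → Bool) → ∣ Vec.tabulate p ∣ ≡ count p
∣tabulate∣ {zero}  p = refl
∣tabulate∣ {suc n} p with p zero
... | true  = cong suc (∣tabulate∣ (p ∘ suc))
... | false = ∣tabulate∣ (p ∘ suc)

count-lookup : ∀ {n} (B : Subset n) → count (lookup B) ≡ ∣ B ∣
count-lookup B = trans (sym (∣tabulate∣ (lookup B))) (cong ∣_∣ (tabulate∘lookup B))

count-split : ∀ {n} (p q : Fin n → Bool) →
              count p ≡ count (λ i → p i ∧ q i) + count (λ i → p i ∧ not (q i))
count-split p q = trans (sum-cong-≗ (λ i → indicator-split (p i) (q i)))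
  (∑-distrib-+ (λ i → indicator (p i ∧ q i)) (λ i → indicator (p i ∧ not (q i))))

select : ∀ {n} (p : Fin n → Bool) → Fin (count p) → Fin n
select {suc n} p i with p zero
select {suc n} p zero    | true  = zero
select {suc n} p (suc i) | true  = suc (select (p ∘ suc) i)
select {suc n} p i       | false = suc (select (p ∘ suc) i)

select-sat : ∀ {n} (p : Fin n → Bool) i → p (select p i) ≡ true
select-sat {suc n} p i with p zero in p0
select-sat {suc n} p zero    | true  = p0
select-sat {suc n} p (suc i) | true  = select-sat (p ∘ suc) i
select-sat {suc n} p i       | false = select-sat (p ∘ suc) i

select-injective : ∀ {n} (p : Fin n → Bool) → Injective _≡_ _≡_ (select p)
select-injective {suc n} p {i} {j} eq with p zero
select-injective {suc n} p {zero}  {zero}  eq | true  = refl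
select-injective {suc n} p {suc i} {suc j} eq | true  =
  cong suc (select-injective (p ∘ suc) (Finₚ.suc-injective eq))
select-injective {suc n} p {i}     {j}     eq | false =
  select-injective (p ∘ suc) (Finₚ.suc-injective eq)

-- The membership proof is irrelevant, so index p v does not depend on how p v ≡ true was obtained.
index : ∀ {n} (p : Fin n → Bool) (v : Fin n) → .(p v ≡ true) → Fin (count p)
index p zero    pv with p zero
index p zero    pv | true  = zero
index p zero    () | false
index p (suc v) pv with p zero
... | true  = suc (index (p ∘ suc) v pv)
... | false = index (p ∘ suc) v pv

select-index : ∀ {n} (p : Fin n → Bool) v .(pv : p v ≡ true) → select p (index p v pv) ≡ v
select-index p zero    pv with p zero
select-index p zero    pv | true  = refl
select-index p zero    () | false
select-index p (suc v) pv with p zero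
... | true  = cong suc (select-index (p ∘ suc) v pv)
... | false = cong suc (select-index (p ∘ suc) v pv)

index-injective : ∀ {n} (p : Fin n → Bool) {u v} .(pu : p u ≡ true) .(pv : p v ≡ true) →
                  index p u pu ≡ index p v pv → u ≡ v
index-injective p {u} {v} pu pv eq =
  trans (sym (select-index p u pu)) (trans (cong (select p) eq) (select-index p v pv))

index-cong : ∀ {n} (p : Fin n → Bool) {u v} .(pu : p u ≡ true) .(pv : p v ≡ true) →
             u ≡ v → index p u pu ≡ index p v pv
index-cong p pu pv refl = refl

toℕ-index-injective : ∀ {n} {p q : Fin n → Bool} → p ≡ q → ∀ {u v} .(pu : p u ≡ true) .(qv : q v ≡ true) →
                      toℕ (index p u pu) ≡ toℕ (index q v qv) → u ≡ v
toℕ-index-injective {p = p} refl pu qv eq = index-injective p pu qv (toℕ-injective eq)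

injective⇒≤count : ∀ {m n} (p : Fin n → Bool) (f : Fin m → Fin n) →
                    Injective _≡_ _≡_ f → (∀ i → p (f i) ≡ true) → m ≤ count p
injective⇒≤count p f f-injective pf =
  injective⇒≤ (λ {i} {j} eq → f-injective (index-injective p (pf i) (pf j) eq))

count-≤1 : ∀ {n} (p : Fin n → Bool) → (∀ {u v} → p u ≡ true → p v ≡ true → u ≡ v) → count p ≤ 1
count-≤1 p unique = injective⇒≤ {f = λ _ → zero}
  (λ {i} {j} _ → select-injective p (unique (select-sat p i) (select-sat p j)))

count-pos⇒∃ : ∀ {n} (p : Fin n → Bool) → 1 ≤ count p → ∃ λ v → p v ≡ true
count-pos⇒∃ p 1≤count = select p (fromℕ< 1≤count) , select-sat p _

injective⇒strictlySurjective : ∀ {m n} {f : Fin m → Fin n} → n ≤ m →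
                                Injective _≡_ _≡_ f → StrictlySurjective _≡_ f
injective⇒strictlySurjective {m} {suc n} {f} n≤m f-injective y with any? (λ x → f x ≟ᶠ y)
... | yes hit = hit
... | no miss = contradiction (injective⇒≤ missing-injective) (<⇒≱ n≤m)
  where
  missing : Fin m → Fin n
  missing x = punchOut (λ fx≡y → miss (x , sym fx≡y))
  missing-injective : Injective _≡_ _≡_ missing
  missing-injective {x} {x′} =
    f-injective ∘ punchOut-injective (λ e → miss (x , sym e)) (λ e → miss (x′ , sym e))

encode : ∀ {t s k} → Fin t × Fin s × Fin k → Fin (t * (s * k))
encode (i , j , l) = combine i (combine j l)

encode-injective : ∀ {t s k} → Injective _≡_ _≡_ (encode {t} {s} {k})
encode-injective {x = i , j , l} {i′ , j′ , l′} eq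
  with refl , eq′ ← combine-injective i (combine j l) i′ (combine j′ l′) eq
  with refl , refl ← combine-injective j l j′ l′ eq′ = refl

does-<?-flip : ∀ {n} {x y : Fin n} → x ≢ y → does (y <?ᶠ x) ≡ not (does (x <?ᶠ y))
does-<?-flip {x = x} {y} x≢y with <-cmp x y
... | tri< x<y _ _ = trans (dec-false (y <?ᶠ x) (<-asym x<y)) (cong not (sym (dec-true (x <?ᶠ y) x<y)))
... | tri≈ _ x≡y _ = contradiction x≡y x≢y
... | tri> _ _ y<x = trans (dec-true (y <?ᶠ x) y<x) (cong not (sym (dec-false (x <?ᶠ y) (<-asym y<x))))

fin2-≢⇒≡ : ∀ {a b c : Fin 2} → a ≢ c → b ≢ c → a ≡ b
fin2-≢⇒≡ {zero}     {zero}                _   _   = refl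
fin2-≢⇒≡ {suc zero} {suc zero}            _   _   = refl
fin2-≢⇒≡ {zero}     {suc zero} {zero}     a≢c _   = contradiction refl a≢c
fin2-≢⇒≡ {zero}     {suc zero} {suc zero} _   b≢c = contradiction refl b≢c
fin2-≢⇒≡ {suc zero} {zero}     {zero}     _   b≢c = contradiction refl b≢c
fin2-≢⇒≡ {suc zero} {zero}     {suc zero} a≢c _   = contradiction refl a≢c

opposite-≢ : ∀ (a : Fin 2) → a ≢ opposite a
opposite-≢ zero       ()
opposite-≢ (suc zero) ()

isZero : ∀ {k} → Fin (suc k) → Bool
isZero zero    = true
isZero (suc _) = false

isZero-sound : ∀ {k} {x : Fin (suc k)} → isZero x ≡ true → x ≡ zero
isZero-sound {x = zero} _ = refl

-- Double counting against an open packing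

module _ {n : ℕ} (G : Graph n) where
  open Graph G

  Adj-sym : ∀ {u v} → Adj G u v → Adj G v u
  Adj-sym {u} {v} uv = trans (adj-sym v u) uv

  Adj-irreflexive : ∀ {u v} → Adj G u v → u ≢ v
  Adj-irreflexive {u} uu refl = contradiction (trans (sym uu) (adj-irrefl u)) λ ()

  deg≡count : ∀ v → deg G v ≡ count (adj v)
  deg≡count v = sum-map-tabulate n id (λ w → indicator (adj v w))

  IsOpenPacking′ : (Fin n → Bool) → Set
  IsOpenPacking′ b = ∀ {u v w} → b u ≡ true → b v ≡ true → Adj G u w → Adj G v w → u ≡ v

  fromIsOpenPacking : ∀ {B} → IsOpenPacking G B → IsOpenPacking′ (lookup B)
  fromIsOpenPacking {B} packing {u} {v} {w} bu bv uw vw with u ≟ᶠ v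
  ... | yes u≡v = u≡v
  ... | no u≢v  = contradiction (uw , vw) (packing u v (lookup⇒[]= u B bu) (lookup⇒[]= v B bv) u≢v w)

  neighboursIn : (Fin n → Bool) → Fin n → ℕ
  neighboursIn b w = count (λ u → b u ∧ adj u w)

  neighboursIn-≤1 : ∀ {b} → IsOpenPacking′ b → ∀ w → neighboursIn b w ≤ 1
  neighboursIn-≤1 {b} packing w = count-≤1 _ λ {u} {v} pu pv →
    packing (∧-conicalˡ (b u) _ pu) (∧-conicalˡ (b v) _ pv) (∧-conicalʳ (b u) _ pu) (∧-conicalʳ (b v) _ pv)

  ∑-deg≡∑-neighboursIn : ∀ b → ∑[ u < n ] (indicator (b u) * deg G u) ≡ ∑[ w < n ] neighboursIn b w
  ∑-deg≡∑-neighboursIn b = begin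
    ∑[ u < n ] (indicator (b u) * deg G u)
      ≡⟨ sum-cong-≗ (λ u → cong (indicator (b u) *_) (deg≡count u)) ⟩
    ∑[ u < n ] (indicator (b u) * count (adj u))
      ≡⟨ sum-cong-≗ (λ u → *-distribˡ-sum (indicator (b u)) (λ w → indicator (adj u w))) ⟩
    ∑[ u < n ] ∑[ w < n ] (indicator (b u) * indicator (adj u w))
      ≡⟨ sum-cong-≗ (λ u → sum-cong-≗ (λ w → sym (indicator-∧ (b u) (adj u w)))) ⟩
    ∑[ u < n ] ∑[ w < n ] indicator (b u ∧ adj u w)
      ≡⟨ ∑-comm (λ u w → indicator (b u ∧ adj u w)) ⟩
    ∑[ w < n ] neighboursIn b w ∎
    where open ≡-Reasoning

  module _ {b : Fin n → Bool} (packing : IsOpenPacking′ b) {d : ℕ} (d≤deg : ∀ v → d ≤ deg G v) where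

    private
      count*δ≡∑ : count b * d ≡ ∑[ u < n ] (indicator (b u) * d)
      count*δ≡∑ = *-distribʳ-sum d (λ u → indicator (b u))

      δ≤deg-on-b : ∀ u → indicator (b u) * d ≤ indicator (b u) * deg G u
      δ≤deg-on-b u = *-monoʳ-≤ (indicator (b u)) (d≤deg u)

      ∑-neighboursIn≤n : ∑[ w < n ] neighboursIn b w ≤ n
      ∑-neighboursIn≤n = ≤-trans (∑-mono-≤ (neighboursIn-≤1 packing)) (≤-reflexive (∑-one n))

    count*δ≤n : count b * d ≤ n
    count*δ≤n = begin
      count b * d                              ≡⟨ count*δ≡∑ ⟩
      ∑[ u < n ] (indicator (b u) * d)         ≤⟨ ∑-mono-≤ δ≤deg-on-b ⟩
      ∑[ u < n ] (indicator (b u) * deg G u)   ≡⟨ ∑-deg≡∑-neighboursIn b ⟩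
      ∑[ w < n ] neighboursIn b w              ≤⟨ ∑-neighboursIn≤n ⟩
      n                                        ∎
      where open ≤-Reasoning

    module _ (tight : count b * d ≡ n) where

      neighboursIn≡1 : ∀ w → neighboursIn b w ≡ 1
      neighboursIn≡1 = ∑-mono-≤-equality (neighboursIn-≤1 packing) (begin
        ∑[ w < n ] 1                             ≡⟨ ∑-one n ⟩
        n                                        ≡⟨ tight ⟨
        count b * d                              ≡⟨ count*δ≡∑ ⟩
        ∑[ u < n ] (indicator (b u) * d)         ≤⟨ ∑-mono-≤ δ≤deg-on-b ⟩
        ∑[ u < n ] (indicator (b u) * deg G u)   ≡⟨ ∑-deg≡∑-neighboursIn b ⟩
        ∑[ w < n ] neighboursIn b w              ∎)
        where open ≤-Reasoning

      private
        δ≡deg-on-b : ∀ u → indicator (b u) * d ≡ indicator (b u) * deg G u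
        δ≡deg-on-b = ∑-mono-≤-equality δ≤deg-on-b (begin
          ∑[ u < n ] (indicator (b u) * deg G u)   ≡⟨ ∑-deg≡∑-neighboursIn b ⟩
          ∑[ w < n ] neighboursIn b w              ≤⟨ ∑-neighboursIn≤n ⟩
          n                                        ≡⟨ tight ⟨
          count b * d                              ≡⟨ count*δ≡∑ ⟩
          ∑[ u < n ] (indicator (b u) * d)         ∎)
          where open ≤-Reasoning

      deg≡δ : ∀ {u} → b u ≡ true → deg G u ≡ d
      deg≡δ {u} bu = begin
        deg G u       ≡⟨ *-identityˡ (deg G u) ⟨
        1 * deg G u   ≡⟨ subst (λ x → indicator x * d ≡ indicator x * deg G u) bu (δ≡deg-on-b u) ⟨
        1 * d         ≡⟨ *-identityˡ d ⟩
        d             ∎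
        where open ≡-Reasoning

  packing-number*δ≤n : ∀ {d r} → IsMinDegree G d → IsOpenPackingNumber G r → r * d ≤ n
  packing-number*δ≤n {d} (_ , d≤deg) ((B , B-packing , ∣B∣≡r) , _) =
    subst (λ x → x * d ≤ n) (trans (count-lookup B) ∣B∣≡r)
      (count*δ≤n (fromIsOpenPacking B-packing) d≤deg)

-- Graphs in Γ attain the bound

module _ {n : ℕ} (G : Graph n) {t k : ℕ} (φ : Fin n ⤖ (Fin t × Fin 2 × Fin (suc k)))
         (structure : GammaStructure G t k φ) where
  open Graph G
  open Bijection φ using () renaming (to to label; injective to label-injective; surjective to label-surjective)

  private
    copy′ : Fin n → Fin t
    copy′ = copy G t k φ

    side′ : Fin n → Fin 2
    side′ = side G t k φ

    role′ : Fin n → Fin (suc k)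
    role′ = role G t k φ

    H-adj : ∀ u v → role′ u ≡ zero → role′ v ≡ zero → Adj G u v ⇔ (copy′ u ≡ copy′ v × u ≢ v)
    H-adj = proj₁ structure

    pn-adj : ∀ u v → role′ u ≡ zero → role′ v ≢ zero → Adj G u v ⇔ (copy′ u ≡ copy′ v × side′ u ≡ side′ v)
    pn-adj = proj₁ (proj₂ structure)

    pn-deg : ∀ v → role′ v ≢ zero → suc k ≤ deg G v
    pn-deg = proj₂ (proj₂ structure)

    vertex : Fin t × Fin 2 × Fin (suc k) → Fin n
    vertex y = proj₁ (label-surjective y)

    label-vertex : ∀ y → label (vertex y) ≡ y
    label-vertex y = proj₂ (label-surjective y) refl

    label≡ : ∀ {u v} → copy′ u ≡ copy′ v → side′ u ≡ side′ v → role′ u ≡ role′ v → u ≡ v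
    label≡ c s r = label-injective (cong₂ _,_ c (cong₂ _,_ s r))

  isH : Fin n → Bool
  isH v = isZero (role′ v)

  in-H : ∀ {v} → v ∈ Vec.tabulate isH → role′ v ≡ zero
  in-H {v} v∈H = isZero-sound (trans (sym (lookup∘tabulate isH v)) ([]=⇒lookup v∈H))

  H-isOpenPacking : IsOpenPacking G (Vec.tabulate isH)
  H-isOpenPacking u v u∈H v∈H u≢v w (uw , vw) with role′ w ≟ᶠ zero
  ... | yes rw = u≢v (label≡ (trans cu (sym cv)) (fin2-≢⇒≡ su≢sw sv≢sw) (trans (in-H u∈H) (sym (in-H v∈H))))
    where
    cu : copy′ u ≡ copy′ w
    cu = proj₁ (Equivalence.to (H-adj u w (in-H u∈H) rw) uw)
    cv : copy′ v ≡ copy′ w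
    cv = proj₁ (Equivalence.to (H-adj v w (in-H v∈H) rw) vw)
    su≢sw : side′ u ≢ side′ w
    su≢sw s = proj₂ (Equivalence.to (H-adj u w (in-H u∈H) rw) uw) (label≡ cu s (trans (in-H u∈H) (sym rw)))
    sv≢sw : side′ v ≢ side′ w
    sv≢sw s = proj₂ (Equivalence.to (H-adj v w (in-H v∈H) rw) vw) (label≡ cv s (trans (in-H v∈H) (sym rw)))
  ... | no rw = u≢v (label≡ (trans (proj₁ u∼w) (sym (proj₁ v∼w))) (trans (proj₂ u∼w) (sym (proj₂ v∼w)))
                             (trans (in-H u∈H) (sym (in-H v∈H))))
    where
    u∼w : copy′ u ≡ copy′ w × side′ u ≡ side′ w
    u∼w = Equivalence.to (pn-adj u w (in-H u∈H) rw) uw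
    v∼w : copy′ v ≡ copy′ w × side′ v ≡ side′ w
    v∼w = Equivalence.to (pn-adj v w (in-H v∈H) rw) vw

  private
    -- v itself if v ∈ V(H), and u if v ∈ pn(u)
    hub : Fin n → Fin n
    hub v = vertex (copy′ v , side′ v , zero)

    hub-in-H : ∀ v → isH (hub v) ≡ true
    hub-in-H v = cong (isZero ∘ proj₂ ∘ proj₂) (label-vertex (copy′ v , side′ v , zero))

    hub-and-role : Fin n → Fin (count isH * suc k)
    hub-and-role v = combine (index isH (hub v) (hub-in-H v)) (role′ v)

    hub-and-role-injective : Injective _≡_ _≡_ hub-and-role
    hub-and-role-injective {u} {v} eq
      with same-hub , same-role ← combine-injective _ _ _ _ eq =
      label≡ (cong proj₁ same-label) (cong (proj₁ ∘ proj₂) same-label) same-role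
      where
      same-label : (copy′ u , side′ u , zero) ≡ (copy′ v , side′ v , zero)
      same-label = trans (sym (label-vertex _))
        (trans (cong label (index-injective isH (hub-in-H u) (hub-in-H v) same-hub)) (label-vertex _))

  n≤|H|*[k+1] : n ≤ count isH * suc k
  n≤|H|*[k+1] = injective⇒≤ hub-and-role-injective

  H-deg : ∀ v → role′ v ≡ zero → suc k ≤ deg G v
  H-deg v rv = subst (suc k ≤_) (sym (deg≡count G v))
    (injective⇒≤count (adj v) neighbour neighbour-injective adjacent)
    where
    neighbour : Fin (suc k) → Fin n
    neighbour zero    = vertex (copy′ v , opposite (side′ v) , zero)
    neighbour (suc l) = vertex (copy′ v , side′ v , suc l)
    copy-neighbour : ∀ i → copy′ v ≡ copy′ (neighbour i)
    copy-neighbour zero    = sym (cong proj₁ (label-vertex _))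
    copy-neighbour (suc l) = sym (cong proj₁ (label-vertex _))
    role-neighbour : ∀ i → role′ (neighbour i) ≡ i
    role-neighbour zero    = cong (proj₂ ∘ proj₂) (label-vertex _)
    role-neighbour (suc l) = cong (proj₂ ∘ proj₂) (label-vertex _)
    neighbour-injective : Injective _≡_ _≡_ neighbour
    neighbour-injective {i} {j} eq = trans (sym (role-neighbour i)) (trans (cong role′ eq) (role-neighbour j))
    adjacent : ∀ i → adj v (neighbour i) ≡ true
    adjacent zero = Equivalence.from (H-adj v _ rv (role-neighbour zero)) (copy-neighbour zero ,
      λ eq → opposite-≢ (side′ v) (trans (cong side′ eq) (cong (proj₁ ∘ proj₂) (label-vertex _))))
    adjacent (suc l) = Equivalence.from (pn-adj v _ rv (λ eq → 0≢1+n (trans (sym eq) (role-neighbour (suc l)))))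
      (copy-neighbour (suc l) , sym (cong (proj₁ ∘ proj₂) (label-vertex _)))

  [k+1]≤deg : ∀ v → suc k ≤ deg G v
  [k+1]≤deg v with role′ v ≟ᶠ zero
  ... | yes rv = H-deg v rv
  ... | no rv  = pn-deg v rv

  Γ⇒tight : ∀ {d r} → IsMinDegree G d → IsOpenPackingNumber G r → r * d ≡ n
  Γ⇒tight {d} {r} δ@((v , deg-v≡d) , _) ρ@(_ , maximal) = ≤-antisym (packing-number*δ≤n G δ ρ) (begin
    n                  ≤⟨ n≤|H|*[k+1] ⟩
    count isH * suc k  ≤⟨ *-mono-≤ |H|≤r (subst (suc k ≤_) deg-v≡d ([k+1]≤deg v)) ⟩
    r * d              ∎)
    where
    open ≤-Reasoning
    |H|≤r : count isH ≤ r
    |H|≤r = subst (_≤ r) (∣tabulate∣ isH) (maximal _ H-isOpenPacking)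

-- A perfect open packing yields the structure of Γ

-- b is V(H) and π w the unique neighbour of w in V(H); the copies of K₂ are the pairs {a, π a},
-- each indexed by its leader, the smaller of its two ends, and pn a is the paper's pn(a).
module PerfectPacking {n : ℕ} (G : Graph n) {b : Fin n → Bool} (packing : IsOpenPacking′ G b)
                      (dominating : ∀ w → neighboursIn G b w ≡ 1) where
  open Graph G

  private
    owner : ∀ w → ∃ λ u → (b u ∧ adj u w) ≡ true
    owner w = count-pos⇒∃ _ (≤-reflexive (sym (dominating w)))

  π : Fin n → Fin n
  π w = proj₁ (owner w)

  π∈b : ∀ w → b (π w) ≡ true
  π∈b w = ∧-conicalˡ _ _ (proj₂ (owner w))

  π-adj : ∀ w → Adj G (π w) w
  π-adj w = ∧-conicalʳ (b (π w)) _ (proj₂ (owner w))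

  π-unique : ∀ {u w} → b u ≡ true → Adj G u w → u ≡ π w
  π-unique bu uw = packing bu (π∈b _) uw (π-adj _)

  π-involutive : ∀ {a} → b a ≡ true → π (π a) ≡ a
  π-involutive {a} ba = sym (π-unique ba (Adj-sym G (π-adj a)))

  π-≢ : ∀ a → a ≢ π a
  π-≢ a = Adj-irreflexive G (Adj-sym G (π-adj a))

  pn : Fin n → Fin n → Bool
  pn a w = adj a w ∧ not (b w)

  deg≡1+|pn| : ∀ a → deg G a ≡ suc (count (pn a))
  deg≡1+|pn| a = begin
    deg G a                                      ≡⟨ deg≡count G a ⟩
    count (adj a)                                ≡⟨ count-split (adj a) b ⟩
    count (λ w → adj a w ∧ b w) + count (pn a)   ≡⟨ cong (_+ count (pn a)) neighbours-in-b ⟩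
    suc (count (pn a))                           ∎
    where
    open ≡-Reasoning
    neighbours-in-b : count (λ w → adj a w ∧ b w) ≡ 1
    neighbours-in-b = trans
      (sum-cong-≗ (λ w → cong indicator (trans (∧-comm (adj a w) (b w)) (cong (b w ∧_) (adj-sym a w)))))
      (dominating a)

  before : Fin n → Bool
  before a = does (a <?ᶠ π a)

  before-π : ∀ {a} → b a ≡ true → before (π a) ≡ not (before a)
  before-π {a} ba = trans (cong (λ x → does (π a <?ᶠ x)) (π-involutive ba)) (does-<?-flip (π-≢ a))

  isLeader : Fin n → Bool
  isLeader a = b a ∧ before a

  isFollower : Fin n → Bool
  isFollower a = b a ∧ not (before a)

  lead : Fin n → Fin n
  lead a = if before a then a else π a

  lead-isLeader : ∀ {a} → b a ≡ true → isLeader (lead a) ≡ true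
  lead-isLeader {a} ba with before a in e
  ... | true  = cong₂ _∧_ ba e
  ... | false = cong₂ _∧_ (π∈b a) (trans (before-π ba) (cong not e))

  lead-π : ∀ {a} → b a ≡ true → lead (π a) ≡ lead a
  lead-π {a} ba with before a in e | before (π a) in e′
  ... | true  | false = π-involutive ba
  ... | false | true  = refl
  ... | true  | true  = contradiction (trans (sym e′) (before-π ba)) (not-¬ (sym e))
  ... | false | false = contradiction (trans (sym e′) (before-π ba)) (not-¬ (sym e))

  lead-≡ : ∀ {a a′} → b a ≡ true → b a′ ≡ true → lead a ≡ lead a′ → a ≡ a′ ⊎ a ≡ π a′
  lead-≡ {a} {a′} ba ba′ eq with before a | before a′
  ... | true  | true  = inj₁ eq
  ... | true  | false = inj₂ eq
  ... | false | true  = inj₂ (trans (sym (π-involutive ba)) (cong π eq))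
  ... | false | false = inj₁ (trans (sym (π-involutive ba)) (trans (cong π eq) (π-involutive ba′)))

  leader⇒follower : ∀ {a} → isLeader a ≡ true → isFollower (π a) ≡ true
  leader⇒follower {a} la = cong₂ _∧_ (π∈b a)
    (trans (cong not (before-π (∧-conicalˡ (b a) _ la))) (trans (not-involutive _) (∧-conicalʳ (b a) _ la)))

  |leaders|≤|followers| : count isLeader ≤ count isFollower
  |leaders|≤|followers| = injective⇒≤count isFollower (π ∘ select isLeader) π∘select-injective
    (λ i → leader⇒follower (select-sat isLeader i))
    where
    in-b : ∀ i → b (select isLeader i) ≡ true
    in-b i = ∧-conicalˡ _ _ (select-sat isLeader i)
    π∘select-injective : Injective _≡_ _≡_ (π ∘ select isLeader)
    π∘select-injective {i} {j} eq = select-injective isLeader (begin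
      select isLeader i          ≡⟨ π-involutive (in-b i) ⟨
      π (π (select isLeader i))  ≡⟨ cong π eq ⟩
      π (π (select isLeader j))  ≡⟨ π-involutive (in-b j) ⟩
      select isLeader j          ∎)
      where open ≡-Reasoning

  anchor : Fin n → Fin n
  anchor v = if b v then v else π v

  anchor∈b : ∀ v → b (anchor v) ≡ true
  anchor∈b v with b v in e
  ... | true  = e
  ... | false = π∈b v

  anchor-b : ∀ {v} → b v ≡ true → anchor v ≡ v
  anchor-b {v} bv = cong (λ x → if x then v else π v) bv

  anchor-¬b : ∀ {v} → b v ≡ false → anchor v ≡ π v
  anchor-¬b {v} bv = cong (λ x → if x then v else π v) bv

  t : ℕ
  t = count isLeader

  leaders-nonempty : Fin n → 1 ≤ t
  leaders-nonempty v = injective⇒≤count isLeader (λ _ → lead (anchor v)) (λ { {zero} {zero} _ → refl })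
    (λ _ → lead-isLeader (anchor∈b v))

  copy′ : Fin n → Fin t
  copy′ v = index isLeader (lead (anchor v)) (lead-isLeader (anchor∈b v))

  side′ : Fin n → Fin 2
  side′ v = Inverse.from 2↔Bool (before (anchor v))

  same-copy⇔ : ∀ {u v} → (copy′ u ≡ copy′ v) ⇔ (lead (anchor u) ≡ lead (anchor v))
  same-copy⇔ {u} {v} = mk⇔ (index-injective isLeader _ _)
    (index-cong isLeader (lead-isLeader (anchor∈b u)) (lead-isLeader (anchor∈b v)))

  same-anchor⇔ : ∀ {u v} → (copy′ u ≡ copy′ v × side′ u ≡ side′ v) ⇔ (anchor u ≡ anchor v)
  same-anchor⇔ {u} {v} = mk⇔ to (λ eq → Equivalence.from same-copy⇔ (cong lead eq) , cong side-of eq)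
    where
    side-of : Fin n → Fin 2
    side-of a = Inverse.from 2↔Bool (before a)
    to : copy′ u ≡ copy′ v × side′ u ≡ side′ v → anchor u ≡ anchor v
    to (c , s) with lead-≡ (anchor∈b u) (anchor∈b v) (Equivalence.to same-copy⇔ c)
    ... | inj₁ eq = eq
    ... | inj₂ eq = contradiction (trans (sym same-before) (trans (cong before eq) (before-π (anchor∈b v))))
                                  (not-¬ refl)
      where
      same-before : before (anchor u) ≡ before (anchor v)
      same-before = trans (sym (Inverse.strictlyInverseˡ 2↔Bool _))
        (trans (cong (Inverse.to 2↔Bool) s) (Inverse.strictlyInverseˡ 2↔Bool _))

  module _ {k : ℕ} (deg≡k+1 : ∀ {a} → b a ≡ true → deg G a ≡ suc k) (tight : count b * suc k ≡ n) where

    pn-count : ∀ {a} → b a ≡ true → count (pn a) ≡ k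
    pn-count {a} ba = suc-injective (trans (sym (deg≡1+|pn| a)) (deg≡k+1 ba))

    pnIndex : ∀ v → .(b v ≡ false) → Fin k
    pnIndex v bv = cast (pn-count (π∈b v)) (index (pn (π v)) v (cong₂ _∧_ (π-adj v) (cong not bv)))

    pnIndex-injective : ∀ {u v} .(bu : b u ≡ false) .(bv : b v ≡ false) → π u ≡ π v →
                        pnIndex u bu ≡ pnIndex v bv → u ≡ v
    pnIndex-injective {u} {v} bu bv π-eq eq = toℕ-index-injective (cong pn π-eq) _ _ (begin
      toℕ (index (pn (π u)) u _)  ≡⟨ toℕ-cast _ _ ⟨
      toℕ (pnIndex u bu)          ≡⟨ cong toℕ eq ⟩
      toℕ (pnIndex v bv)          ≡⟨ toℕ-cast _ _ ⟩
      toℕ (index (pn (π v)) v _)  ∎)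
      where open ≡-Reasoning

    -- roleOf receives b v as an explicit argument: abstracting b v inside role′ v is ill-typed.
    private
      roleOf : ∀ v x → b v ≡ x → Fin (suc k)
      roleOf v true  _  = zero
      roleOf v false bv = suc (pnIndex v bv)

      roleOf-zero⇔ : ∀ v x (e : b v ≡ x) → (roleOf v x e ≡ zero) ⇔ (x ≡ true)
      roleOf-zero⇔ v true  e = mk⇔ (λ _ → refl) (λ _ → refl)
      roleOf-zero⇔ v false e = mk⇔ (λ ()) (λ ())

      roleOf-pn : ∀ v x (e : b v ≡ x) (bv : b v ≡ false) → roleOf v x e ≡ suc (pnIndex v bv)
      roleOf-pn v true  e bv = contradiction (trans (sym e) bv) λ ()
      roleOf-pn v false e bv = refl

    role′ : Fin n → Fin (suc k)
    role′ v = roleOf v (b v) refl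

    role≡zero⇔b : ∀ v → (role′ v ≡ zero) ⇔ (b v ≡ true)
    role≡zero⇔b v = roleOf-zero⇔ v (b v) refl

    role-pn : ∀ {v} (bv : b v ≡ false) → role′ v ≡ suc (pnIndex v bv)
    role-pn {v} bv = roleOf-pn v (b v) refl bv

    label : Fin n → Fin t × Fin 2 × Fin (suc k)
    label v = copy′ v , side′ v , role′ v

    label-injective : Injective _≡_ _≡_ label
    label-injective {u} {v} eq = by-membership (b u) (b v) refl refl
      where
      same-anchor : anchor u ≡ anchor v
      same-anchor = Equivalence.to same-anchor⇔ (cong proj₁ eq , cong (proj₁ ∘ proj₂) eq)
      same-role : role′ u ≡ role′ v
      same-role = cong (proj₂ ∘ proj₂) eq
      by-membership : ∀ x y → b u ≡ x → b v ≡ y → u ≡ v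
      by-membership true  true  bu bv = trans (sym (anchor-b bu)) (trans same-anchor (anchor-b bv))
      by-membership true  false bu bv = contradiction
        (trans (sym bv) (Equivalence.to (role≡zero⇔b v) (trans (sym same-role) (Equivalence.from (role≡zero⇔b u) bu))))
        λ ()
      by-membership false true  bu bv = contradiction
        (trans (sym bu) (Equivalence.to (role≡zero⇔b u) (trans same-role (Equivalence.from (role≡zero⇔b v) bv))))
        λ ()
      by-membership false false bu bv = pnIndex-injective bu bv
        (trans (sym (anchor-¬b bu)) (trans same-anchor (anchor-¬b bv)))
        (Finₚ.suc-injective (trans (sym (role-pn bu)) (trans same-role (role-pn bv))))

    |labels|≤n : t * (2 * suc k) ≤ n
    |labels|≤n = begin
      t * (2 * suc k)                        ≡⟨ *-assoc t 2 (suc k) ⟨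
      t * 2 * suc k                          ≡⟨ cong (_* suc k) (*-comm t 2) ⟩
      (t + (t + 0)) * suc k                  ≤⟨ *-monoˡ-≤ (suc k) (+-monoʳ-≤ t (+-monoˡ-≤ 0 |leaders|≤|followers|)) ⟩
      (t + (count isFollower + 0)) * suc k   ≡⟨ cong (λ x → (t + x) * suc k) (+-identityʳ _) ⟩
      (t + count isFollower) * suc k         ≡⟨ cong (_* suc k) (count-split b before) ⟨
      count b * suc k                        ≡⟨ tight ⟩
      n                                      ∎
      where open ≤-Reasoning

    label-surjective : StrictlySurjective _≡_ label
    label-surjective y
      with x , eq ← injective⇒strictlySurjective |labels|≤n (label-injective ∘ encode-injective) (encode y)
      = x , encode-injective eq

    labelling : Fin n ⤖ (Fin t × Fin 2 × Fin (suc k))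
    labelling = mk⤖ (label-injective , strictlySurjective⇒surjective label-surjective)

    Γ-structure : (∀ v → suc k ≤ deg G v) → GammaStructure G t k labelling
    Γ-structure k+1≤deg = H-adj , pn-adj , λ v _ → k+1≤deg v
      where
      H-adj : ∀ u v → role′ u ≡ zero → role′ v ≡ zero → Adj G u v ⇔ (copy′ u ≡ copy′ v × u ≢ v)
      H-adj u v ru rv = mk⇔ to from
        where
        bu : b u ≡ true
        bu = Equivalence.to (role≡zero⇔b u) ru
        bv : b v ≡ true
        bv = Equivalence.to (role≡zero⇔b v) rv
        to : Adj G u v → copy′ u ≡ copy′ v × u ≢ v
        to uv = Equivalence.from same-copy⇔ (begin
          lead (anchor u)  ≡⟨ cong lead (trans (anchor-b bu) (π-unique bu uv)) ⟩
          lead (π v)       ≡⟨ lead-π bv ⟩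
          lead v           ≡⟨ cong lead (anchor-b bv) ⟨
          lead (anchor v)  ∎) , Adj-irreflexive G uv
          where open ≡-Reasoning
        from : copy′ u ≡ copy′ v × u ≢ v → Adj G u v
        from (c , u≢v)
          with lead-≡ bu bv (subst₂ (λ x y → lead x ≡ lead y) (anchor-b bu) (anchor-b bv) (Equivalence.to same-copy⇔ c))
        ... | inj₁ u≡v  = contradiction u≡v u≢v
        ... | inj₂ u≡πv = subst (λ x → Adj G x v) (sym u≡πv) (π-adj v)
      pn-adj : ∀ u v → role′ u ≡ zero → role′ v ≢ zero → Adj G u v ⇔ (copy′ u ≡ copy′ v × side′ u ≡ side′ v)
      pn-adj u v ru rv = mk⇔
        (λ uv → Equivalence.from same-anchor⇔ (trans (anchor-b bu) (trans (π-unique bu uv) (sym (anchor-¬b bv)))))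
        (λ cs → subst (λ x → Adj G x v) (trans (sym (anchor-¬b bv)) (trans (sym (Equivalence.to same-anchor⇔ cs)) (anchor-b bu))) (π-adj v))
        where
        bu : b u ≡ true
        bu = Equivalence.to (role≡zero⇔b u) ru
        bv : b v ≡ false
        bv = ¬-not (rv ∘ Equivalence.from (role≡zero⇔b v))

tight⇒Γ : ∀ {n} (G : Graph n) → 2 ≤ n → Connected G → ∀ {d r} →
          IsMinDegree G d → IsOpenPackingNumber G r → r * d ≡ n → InΓ G
tight⇒Γ G 2≤n _ {zero} {r} _ _ r*0≡n = contradiction (subst (2 ≤_) (trans (sym r*0≡n) (*-zeroʳ r)) 2≤n) λ ()
tight⇒Γ {n} G (s≤s _) connected {suc k} (_ , k+1≤deg) ((B , B-packing , ∣B∣≡r) , _) r*[k+1]≡n =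
  t , k , leaders-nonempty zero , labelling deg≡k+1 tight , Γ-structure deg≡k+1 tight k+1≤deg , connected
  where
  packing : IsOpenPacking′ G (lookup B)
  packing = fromIsOpenPacking G B-packing
  tight : count (lookup B) * suc k ≡ n
  tight = trans (cong (_* suc k) (trans (count-lookup B) ∣B∣≡r)) r*[k+1]≡n
  deg≡k+1 : ∀ {a} → lookup B a ≡ true → deg G a ≡ suc k
  deg≡k+1 = deg≡δ G packing k+1≤deg tight
  open PerfectPacking G packing (neighboursIn≡1 G packing k+1≤deg tight)

theorem3 : ∀ {n : ℕ} (G : Graph n) → 2 ≤ n → Connected G →
           ∀ (d r : ℕ) → IsMinDegree G d → IsOpenPackingNumber G r →
           ((r * d ≡ n) ⇔ InΓ G)
theorem3 G 2≤n connected d r δ ρ =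
  mk⇔ (tight⇒Γ G 2≤n connected δ ρ) (λ (_ , _ , _ , φ , structure , _) → Γ⇒tight G φ structure δ ρ)
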